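{- If an action of MMA or of MMA$^-$ replaces an equation set $E$ by an equation set $E'$, then $E$ and $E'$ are i-equivalent (and hence equivalent).
   Context: MMA (Martelli–Montanari algorithm) operates on a finite set of equations by nondeterministically choosing an equation and applying: (1) $f(s_1,\ldots,s_n)\doteq f(t_1,\ldots,t_n)$: replace by $s_1\doteq t_1,\ldots,s_n\doteq t_n$; (2) $f(\ldots)\doteq g(\ldots)$, $f\neq g$: halt with failure; (3) $X\doteq X$: delete; (4) $t\doteq X$, $t$ not a variable: replace by $X\doteq t$; (5) $X\doteq t$ with $X\notin Var(t)$ and $X$ occurring elsewhere: apply $\{X/t\}$ to all other equations; (6) $X\doteq t$ with $X\in Var(t)$, $X\ne t$: halt with failure. MMA$^-$ has actions (1)–(4) and, instead of (5),(6): (5a) $X\doteq Y$, $X,Y$ distinct variables, $X$ occurring elsewhere: apply $\{X/Y\}$ to all other equations; (5b) $X\doteq t$, $X\doteq u$ with $t,u$ distinct non-variable terms: with $\{s_1,s_2\}=\{t,u\}$ and $|s_1|\le|s_2|$ (where $|\cdot|$ counts occurrences of variables and function symbols), replace $X\doteq s_2$ by $s_1\doteq s_2$. An i-term is a possibly infinite term over the given alphabet containing only finitely many variables; an i-substitution maps variables to i-terms. A substitution (i-substitution) $\theta$ is a solution (i-solution) of $t\doteq u$ if $t\theta=u\theta$, and of a set of equations if it is one of each equation. Two equation sets are equivalent (i-equivalent) if they have the same solutions (i-solutions). -}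

module Defs where

open import Data.Nat using (ℕ; zero; suc; _+_; _≤_; _<_; _≟_)
open import Data.Fin using (Fin)
open import Data.Vec using (Vec; []; _∷_; toList; zipWith)
open import Data.Vec.Membership.Propositional as VecMem using ()
open import Data.List using (List; []; _∷_; _++_; map; [_])
open import Data.List.Membership.Propositional using (_∈_; _∉_)
open import Data.List.Relation.Unary.All using (All)
open import Data.List.Relation.Unary.Any using (Any)
open import Data.List.Relation.Binary.Permutation.Propositional using (_↭_)
open import Data.Maybe using (Maybe; just; nothing; Is-just)
open import Data.Sum using (_⊎_; inj₁; inj₂)
open import Data.Product using (Σ; ∃; ∃-syntax; _×_; _,_; proj₁; proj₂)
open import Relation.Nullary using (¬_; yes; no)
open import Relation.Binary.PropositionalEquality using (_≡_; _≢_)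
open import Function.Bundles using (_⇔_)

record Signature : Set₁ where
  field
    Sym   : Set
    arity : Sym → ℕ

Var : Set
Var = ℕ

module _ (Sg : Signature) where
  open Signature Sg

  data Term : Set where
    var : Var → Term
    fun : (f : Sym) → Vec Term (arity f) → Term

  IsVar : Term → Set
  IsVar t = ∃[ x ] (t ≡ var x)

  data _occursIn_ (x : Var) : Term → Set where
    occ-var : x occursIn var x
    occ-arg : ∀ {f ts t} → t VecMem.∈ ts → x occursIn t → x occursIn fun f ts

  mutual
    size : Term → ℕ
    size (var x)    = 1
    size (fun f ts) = suc (sizes ts)

    sizes : ∀ {n} → Vec Term n → ℕ
    sizes []       = 0
    sizes (t ∷ ts) = size t + sizes ts

  mutual
    _⟨_⟩ : Term → (Var → Term) → Term
    var x ⟨ σ ⟩    = σ x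
    fun f ts ⟨ σ ⟩ = fun f (ts ⟨ σ ⟩*)

    _⟨_⟩* : ∀ {n} → Vec Term n → (Var → Term) → Vec Term n
    [] ⟨ σ ⟩*       = []
    (t ∷ ts) ⟨ σ ⟩* = (t ⟨ σ ⟩) ∷ (ts ⟨ σ ⟩*)

  [_↦_] : Var → Term → Var → Term
  [ x ↦ t ] y with y ≟ x
  ... | yes _ = t
  ... | no  _ = var y

  Subst : Set
  Subst = Σ (Var → Term) λ θ → ∃[ xs ] (∀ x → x ∉ xs → θ x ≡ var x)

  Equation : Set
  Equation = Term × Term

  EqSet : Set
  EqSet = List Equation

  applyEq : (Var → Term) → Equation → Equation
  applyEq σ (s , t) = (s ⟨ σ ⟩) , (t ⟨ σ ⟩)

  OccursInEqs : Var → EqSet → Set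
  OccursInEqs x R = Any (λ e → x occursIn proj₁ e ⊎ x occursIn proj₂ e) R

  -- i-terms: possibly infinite terms, given as labelled trees over
  -- positions (lists of argument indices), with finitely many variables.
  Label : Set
  Label = Var ⊎ Sym

  Pos : Set
  Pos = List ℕ

  record ITerm : Set where
    field
      tree     : Pos → Maybe Label
      root     : Is-just (tree [])
      branch   : ∀ p i → Is-just (tree (p ++ [ i ]))
                   ⇔ (∃[ f ] (tree p ≡ just (inj₂ f) × i < arity f))
      finVars  : ∃[ xs ] (∀ p x → tree p ≡ just (inj₁ x) → x ∈ xs)
  open ITerm public

  ISubst : Set
  ISubst = Var → ITerm

  mutual
    inst : Term → ISubst → Pos → Maybe Label
    inst (var x)    θ p       = tree (θ x) p
    inst (fun f ts) θ []      = just (inj₂ f)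
    inst (fun f ts) θ (i ∷ p) = instArg ts θ i p

    instArg : ∀ {n} → Vec Term n → ISubst → ℕ → Pos → Maybe Label
    instArg []       θ i       p = nothing
    instArg (t ∷ ts) θ zero    p = inst t θ p
    instArg (t ∷ ts) θ (suc i) p = instArg ts θ i p

  IsSolution : Subst → EqSet → Set
  IsSolution θ E = All (λ e → proj₁ e ⟨ proj₁ θ ⟩ ≡ proj₂ e ⟨ proj₁ θ ⟩) E

  IsISolution : ISubst → EqSet → Set
  IsISolution θ E = All (λ e → ∀ p → inst (proj₁ e) θ p ≡ inst (proj₂ e) θ p) E

  Equivalent : EqSet → EqSet → Set
  Equivalent E E' = ∀ (θ : Subst) → IsSolution θ E ⇔ IsSolution θ E'

  IEquivalent : EqSet → EqSet → Set
  IEquivalent E E' = ∀ (θ : ISubst) → IsISolution θ E ⇔ IsISolution θ E'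

  -- Actions. The equation set is a list; the chosen equation(s) are
  -- brought to the front by a permutation (set semantics).
  -- Failure actions (2) and (6) produce no new set and are omitted.
  data MMAStep : EqSet → EqSet → Set where
    decompose : ∀ {E R f} {ss ts : Vec Term (arity f)} →
      E ↭ ((fun f ss , fun f ts) ∷ R) →
      MMAStep E (toList (zipWith _,_ ss ts) ++ R)
    delete : ∀ {E R x} →
      E ↭ ((var x , var x) ∷ R) →
      MMAStep E R
    swap : ∀ {E R x t} → ¬ IsVar t →
      E ↭ ((t , var x) ∷ R) →
      MMAStep E ((var x , t) ∷ R)
    eliminate : ∀ {E R x t} → ¬ (x occursIn t) → OccursInEqs x R →
      E ↭ ((var x , t) ∷ R) →
      MMAStep E ((var x , t) ∷ map (applyEq [ x ↦ t ]) R)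

  data MMA⁻Step : EqSet → EqSet → Set where
    decompose : ∀ {E R f} {ss ts : Vec Term (arity f)} →
      E ↭ ((fun f ss , fun f ts) ∷ R) →
      MMA⁻Step E (toList (zipWith _,_ ss ts) ++ R)
    delete : ∀ {E R x} →
      E ↭ ((var x , var x) ∷ R) →
      MMA⁻Step E R
    swap : ∀ {E R x t} → ¬ IsVar t →
      E ↭ ((t , var x) ∷ R) →
      MMA⁻Step E ((var x , t) ∷ R)
    eliminateVar : ∀ {E R x y} → x ≢ y → OccursInEqs x R →
      E ↭ ((var x , var y) ∷ R) →
      MMA⁻Step E ((var x , var y) ∷ map (applyEq [ x ↦ var y ]) R)
    -- (5b) with s₁ = t, s₂ = u (the case s₁ = u, s₂ = t is covered by
    -- permuting the two chosen equations)
    replace : ∀ {E R x t u} → ¬ IsVar t → ¬ IsVar u → t ≢ u →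
      size t ≤ size u →
      E ↭ ((var x , t) ∷ (var x , u) ∷ R) →
      MMA⁻Step E ((var x , t) ∷ (t , u) ∷ R)

{-# OPTIONS --safe #-}
module Submission where

open import Defs hiding (_⟨_⟩; _⟨_⟩*; [_↦_])
import Defs as D
open import Data.Nat using (zero; suc; _≟_)
open import Data.Vec using (Vec; []; _∷_; toList; zipWith)
open import Data.Vec.Properties using (∷-injective)
open import Data.List using ([]; _∷_; _++_; map)
open import Data.List.Relation.Unary.All as All using (All; []; _∷_)
open import Data.List.Relation.Unary.All.Properties using (++⁺; ++⁻; map⁺; map⁻)
open import Data.List.Relation.Binary.Permutation.Propositional using (_↭_; ↭-sym)
open import Data.List.Relation.Binary.Permutation.Propositional.Properties using (All-resp-↭)
open import Data.Product using (_×_; _,_; proj₁; proj₂)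
open import Data.Sum using (_⊎_; inj₁; inj₂)
open import Function.Bundles using (_⇔_; mk⇔; Equivalence)
import Function.Properties.Equivalence as ⇔
open import Relation.Nullary using (yes; no)
open import Relation.Binary.Core using (Rel)
open import Relation.Binary.Structures using (IsEquivalence)
open import Level using (0ℓ)
open import Relation.Binary.PropositionalEquality as ≡ using (_≡_; refl; cong; cong₂)

-- Whether θ solves s ≐ t, for θ a substitution or an i-substitution, is a relation
-- s ≈ t on terms that is an equivalence, decomposes along equal head symbols, and
-- satisfies s ≈ s{X/t} whenever X ≈ t. Each action only rewrites the equation set
-- using these three properties, so it preserves the solutions in both senses.

module _ {Sg : Signature} where
  open Signature Sg using (arity)

  _⟨_⟩ : Term Sg → (Var → Term Sg) → Term Sg
  _⟨_⟩ = D._⟨_⟩ Sg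

  _⟨_⟩* : ∀ {n} → Vec (Term Sg) n → (Var → Term Sg) → Vec (Term Sg) n
  _⟨_⟩* = D._⟨_⟩* Sg

  [_↦_] : Var → Term Sg → Var → Term Sg
  [_↦_] = D.[_↦_] Sg

  pairs : ∀ {n} → Vec (Term Sg) n → Vec (Term Sg) n → EqSet Sg
  pairs ss ts = toList (zipWith _,_ ss ts)

  Holds : Rel (Term Sg) 0ℓ → EqSet Sg → Set
  Holds _≈_ = All (λ e → proj₁ e ≈ proj₂ e)

  [↦]-elim : (P : Var → Term Sg → Set) → ∀ {x t} → P x t → (∀ y → P y (var y)) →
             ∀ y → P y ([ x ↦ t ] y)
  [↦]-elim P {x} Pxt Pvar y with y ≟ x
  ... | yes refl = Pxt
  ... | no  _    = Pvar y

  record IsSolutionRelation (_≈_ : Rel (Term Sg) 0ℓ) : Set where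
    field
      isEquivalence : IsEquivalence _≈_
      fun-≈⇔        : ∀ {f} (ss ts : Vec (Term Sg) (arity f)) →
                      fun f ss ≈ fun f ts ⇔ Holds _≈_ (pairs ss ts)
      ≈-[↦]         : ∀ {x t} → var x ≈ t → ∀ s → s ≈ (s ⟨ [ x ↦ t ] ⟩)

  module SolutionRelation {_≈_ : Rel (Term Sg) 0ℓ} (isRel : IsSolutionRelation _≈_) where
    open IsSolutionRelation isRel
    open IsEquivalence isEquivalence renaming (refl to ≈-refl; sym to ≈-sym; trans to ≈-trans)

    Holds-resp-↭ : ∀ {E F} → E ↭ F → Holds _≈_ E ⇔ Holds _≈_ F
    Holds-resp-↭ π = mk⇔ (All-resp-↭ π) (All-resp-↭ (↭-sym π))

    decompose-⇔ : ∀ {f} (ss ts : Vec (Term Sg) (arity f)) R →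
                  Holds _≈_ ((fun f ss , fun f ts) ∷ R) ⇔ Holds _≈_ (pairs ss ts ++ R)
    decompose-⇔ ss ts R = mk⇔
      (λ { (h ∷ hs) → ++⁺ (Equivalence.to (fun-≈⇔ ss ts) h) hs })
      (λ hs → let (hs₁ , hs₂) = ++⁻ (pairs ss ts) hs
              in Equivalence.from (fun-≈⇔ ss ts) hs₁ ∷ hs₂)

    delete-⇔ : ∀ {t} R → Holds _≈_ ((t , t) ∷ R) ⇔ Holds _≈_ R
    delete-⇔ R = mk⇔ (λ { (_ ∷ hs) → hs }) (≈-refl ∷_)

    swap-⇔ : ∀ {t u} R → Holds _≈_ ((t , u) ∷ R) ⇔ Holds _≈_ ((u , t) ∷ R)
    swap-⇔ R = mk⇔ (λ { (h ∷ hs) → ≈-sym h ∷ hs })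
                   (λ { (h ∷ hs) → ≈-sym h ∷ hs })

    replace-⇔ : ∀ {s t u} R →
                Holds _≈_ ((s , t) ∷ (s , u) ∷ R) ⇔ Holds _≈_ ((s , t) ∷ (t , u) ∷ R)
    replace-⇔ R = mk⇔ (λ { (h ∷ k ∷ hs) → h ∷ ≈-trans (≈-sym h) k ∷ hs })
                      (λ { (h ∷ k ∷ hs) → h ∷ ≈-trans h k ∷ hs })

    ≈-⟨[↦]⟩⇔ : ∀ {x t s u} → var x ≈ t →
               s ≈ u ⇔ (s ⟨ [ x ↦ t ] ⟩) ≈ (u ⟨ [ x ↦ t ] ⟩)
    ≈-⟨[↦]⟩⇔ {s = s} {u} h = mk⇔
      (λ s≈u → ≈-trans (≈-sym (≈-[↦] h s)) (≈-trans s≈u (≈-[↦] h u)))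
      (λ s≈u → ≈-trans (≈-[↦] h s) (≈-trans s≈u (≈-sym (≈-[↦] h u))))

    eliminate-⇔ : ∀ {x t} R →
                  Holds _≈_ ((var x , t) ∷ R) ⇔
                  Holds _≈_ ((var x , t) ∷ map (applyEq Sg [ x ↦ t ]) R)
    eliminate-⇔ R = mk⇔
      (λ { (h ∷ hs) → h ∷ map⁺ (All.map (Equivalence.to (≈-⟨[↦]⟩⇔ h)) hs) })
      (λ { (h ∷ hs) → h ∷ All.map (Equivalence.from (≈-⟨[↦]⟩⇔ h)) (map⁻ hs) })

    ↭-⇔-trans : ∀ {E F G} → E ↭ F →
                Holds _≈_ F ⇔ Holds _≈_ G → Holds _≈_ E ⇔ Holds _≈_ G
    ↭-⇔-trans π = ⇔.trans (Holds-resp-↭ π)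

    mmaStep-⇔ : ∀ {E E'} → MMAStep Sg E E' → Holds _≈_ E ⇔ Holds _≈_ E'
    mmaStep-⇔ (MMAStep.decompose {R = R} {ss = ss} {ts} π) = ↭-⇔-trans π (decompose-⇔ ss ts R)
    mmaStep-⇔ (MMAStep.delete {R = R} π)                   = ↭-⇔-trans π (delete-⇔ R)
    mmaStep-⇔ (MMAStep.swap {R = R} _ π)                   = ↭-⇔-trans π (swap-⇔ R)
    mmaStep-⇔ (MMAStep.eliminate {R = R} _ _ π)            = ↭-⇔-trans π (eliminate-⇔ R)

    mma⁻Step-⇔ : ∀ {E E'} → MMA⁻Step Sg E E' → Holds _≈_ E ⇔ Holds _≈_ E'
    mma⁻Step-⇔ (MMA⁻Step.decompose {R = R} {ss = ss} {ts} π) = ↭-⇔-trans π (decompose-⇔ ss ts R)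
    mma⁻Step-⇔ (MMA⁻Step.delete {R = R} π)                   = ↭-⇔-trans π (delete-⇔ R)
    mma⁻Step-⇔ (MMA⁻Step.swap {R = R} _ π)                   = ↭-⇔-trans π (swap-⇔ R)
    mma⁻Step-⇔ (MMA⁻Step.eliminateVar {R = R} _ _ π)         = ↭-⇔-trans π (eliminate-⇔ R)
    mma⁻Step-⇔ (MMA⁻Step.replace {R = R} _ _ _ _ π)          = ↭-⇔-trans π (replace-⇔ R)

  module _ (σ : Var → Term Sg) where
    EqualUnder : Rel (Term Sg) 0ℓ
    EqualUnder s t = s ⟨ σ ⟩ ≡ t ⟨ σ ⟩

    Absorbs : (Var → Term Sg) → Set
    Absorbs ρ = ∀ y → σ y ≡ ρ y ⟨ σ ⟩

    mutual
      ⟨⟩-absorbs : ∀ {ρ} → Absorbs ρ → ∀ s → s ⟨ σ ⟩ ≡ s ⟨ ρ ⟩ ⟨ σ ⟩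
      ⟨⟩-absorbs h (var y)    = h y
      ⟨⟩-absorbs h (fun f ts) = cong (fun f) (⟨⟩*-absorbs h ts)

      ⟨⟩*-absorbs : ∀ {ρ n} → Absorbs ρ → (ts : Vec (Term Sg) n) →
                    ts ⟨ σ ⟩* ≡ ts ⟨ ρ ⟩* ⟨ σ ⟩*
      ⟨⟩*-absorbs h []       = refl
      ⟨⟩*-absorbs h (t ∷ ts) = cong₂ _∷_ (⟨⟩-absorbs h t) (⟨⟩*-absorbs h ts)

    ⟨⟩*-≡⇔ : ∀ {n} (ss ts : Vec (Term Sg) n) →
             ss ⟨ σ ⟩* ≡ ts ⟨ σ ⟩* ⇔ Holds EqualUnder (pairs ss ts)
    ⟨⟩*-≡⇔ []       []       = mk⇔ (λ _ → []) (λ _ → refl)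
    ⟨⟩*-≡⇔ (s ∷ ss) (t ∷ ts) = mk⇔
      (λ eq → let (eq₁ , eq₂) = ∷-injective eq
              in eq₁ ∷ Equivalence.to (⟨⟩*-≡⇔ ss ts) eq₂)
      (λ { (h ∷ hs) → cong₂ _∷_ h (Equivalence.from (⟨⟩*-≡⇔ ss ts) hs) })

    fun-injective : ∀ {f} {ss ts : Vec (Term Sg) (arity f)} → fun f ss ≡ fun f ts → ss ≡ ts
    fun-injective refl = refl

    equalUnder-isSolutionRelation : IsSolutionRelation EqualUnder
    equalUnder-isSolutionRelation = record
      { isEquivalence = record { refl = refl ; sym = ≡.sym ; trans = ≡.trans }
      ; fun-≈⇔        = λ ss ts → ⇔.trans (mk⇔ fun-injective (cong (fun _))) (⟨⟩*-≡⇔ ss ts)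
      ; ≈-[↦]         = λ h → ⟨⟩-absorbs ([↦]-elim (λ y u → σ y ≡ u ⟨ σ ⟩) h (λ _ → refl))
      }

  module _ (θ : ISubst Sg) where
    SameTreeUnder : Rel (Term Sg) 0ℓ
    SameTreeUnder s t = ∀ p → inst Sg s θ p ≡ inst Sg t θ p

    ArgsSameTreeUnder : ∀ {n} → Rel (Vec (Term Sg) n) 0ℓ
    ArgsSameTreeUnder ss ts = ∀ i p → instArg Sg ss θ i p ≡ instArg Sg ts θ i p

    IAbsorbs : (Var → Term Sg) → Set
    IAbsorbs ρ = ∀ y p → tree (θ y) p ≡ inst Sg (ρ y) θ p

    mutual
      inst-absorbs : ∀ {ρ} → IAbsorbs ρ → ∀ s p → inst Sg s θ p ≡ inst Sg (s ⟨ ρ ⟩) θ p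
      inst-absorbs h (var y)    p       = h y p
      inst-absorbs h (fun f ts) []      = refl
      inst-absorbs h (fun f ts) (i ∷ p) = instArg-absorbs h ts i p

      instArg-absorbs : ∀ {ρ n} → IAbsorbs ρ → (ts : Vec (Term Sg) n) →
                        ∀ i p → instArg Sg ts θ i p ≡ instArg Sg (ts ⟨ ρ ⟩*) θ i p
      instArg-absorbs h []       i       p = refl
      instArg-absorbs h (t ∷ ts) zero    p = inst-absorbs h t p
      instArg-absorbs h (t ∷ ts) (suc i) p = instArg-absorbs h ts i p

    argsSameTree⇔ : ∀ {n} (ss ts : Vec (Term Sg) n) →
                    ArgsSameTreeUnder ss ts ⇔ Holds SameTreeUnder (pairs ss ts)
    argsSameTree⇔ []       []       = mk⇔ (λ _ → []) (λ _ _ _ → refl)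
    argsSameTree⇔ (s ∷ ss) (t ∷ ts) = mk⇔
      (λ eq → eq zero ∷ Equivalence.to (argsSameTree⇔ ss ts) (λ i → eq (suc i)))
      (λ { (h ∷ hs) zero    → h
         ; (h ∷ hs) (suc i) → Equivalence.from (argsSameTree⇔ ss ts) hs i })

    fun-sameTree⇔ : ∀ {f} (ss ts : Vec (Term Sg) (arity f)) →
                    SameTreeUnder (fun f ss) (fun f ts) ⇔ ArgsSameTreeUnder ss ts
    fun-sameTree⇔ ss ts = mk⇔ (λ eq i p → eq (i ∷ p))
                              (λ { eq [] → refl ; eq (i ∷ p) → eq i p })

    sameTreeUnder-isSolutionRelation : IsSolutionRelation SameTreeUnder
    sameTreeUnder-isSolutionRelation = record
      { isEquivalence = record
          { refl  = λ _ → refl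
          ; sym   = λ h p → ≡.sym (h p)
          ; trans = λ h k p → ≡.trans (h p) (k p)
          }
      ; fun-≈⇔        = λ ss ts → ⇔.trans (fun-sameTree⇔ ss ts) (argsSameTree⇔ ss ts)
      ; ≈-[↦]         = λ h → inst-absorbs
                          ([↦]-elim (λ y u → ∀ p → tree (θ y) p ≡ inst Sg u θ p) h (λ _ _ → refl))
      }

step-⇔ : ∀ {Sg} {_≈_ : Rel (Term Sg) 0ℓ} → IsSolutionRelation _≈_ →
         ∀ {E E'} → MMAStep Sg E E' ⊎ MMA⁻Step Sg E E' → Holds _≈_ E ⇔ Holds _≈_ E'
step-⇔ isRel (inj₁ step) = SolutionRelation.mmaStep-⇔ isRel step
step-⇔ isRel (inj₂ step) = SolutionRelation.mma⁻Step-⇔ isRel step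

lemma9 : (Sg : Signature) (E E' : EqSet Sg) →
    MMAStep Sg E E' ⊎ MMA⁻Step Sg E E' →
    IEquivalent Sg E E' × Equivalent Sg E E'
lemma9 Sg E E' step =
    (λ θ → step-⇔ (sameTreeUnder-isSolutionRelation θ) step)
  , (λ θ → step-⇔ (equalUnder-isSolutionRelation (proj₁ θ)) step)
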